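{- (i) For paths $P_m,P_n$ of orders $m\geq 2$ and $n\geq 2$, $D'(P_m\star P_n)=2$, except that $D'(P_2\star P_2)=3$. (ii) For cycles $C_m,C_n$ of orders $m\geq 3$ and $n\geq 3$, $D'(C_m\star C_n)=2$. (iii) For a path $P_m$ of order $m\geq 2$ and a cycle $C_n$ of order $n\geq 3$, $D'(P_m\star C_n)=2$.
   Context: $P_m$ is the path on $m$ vertices and $C_n$ the cycle on $n$ vertices. The co-normal product $G\star H$ has vertex set $V(G)\times V(H)$ and edge set $\{\{(x_1,x_2),(y_1,y_2)\} : x_1y_1\in E(G) \text{ or } x_2y_2\in E(H)\}$. The distinguishing index $D'(G)$ is the least integer $d$ such that $G$ has an edge labeling with $d$ labels preserved only by the trivial automorphism. -}

module Defs where

open import Data.Nat using (ℕ; suc; _∸_; _<_)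
open import Data.Nat.Properties using (_≟_)
open import Data.Fin using (Fin; toℕ)
open import Data.Bool using (Bool; true; _∨_; _∧_)
open import Data.Product using (_×_; _,_; ∃; Σ)
open import Relation.Nullary.Decidable using (⌊_⌋)
open import Relation.Nullary using (¬_)
open import Relation.Binary.PropositionalEquality using (_≡_)
open import Function.Bundles using (_↔_; Inverse)

record Graph : Set₁ where
  field
    V   : Set
    adj : V → V → Bool
open Graph public

pathAdj : (m : ℕ) → Fin m → Fin m → Bool
pathAdj m i j = ⌊ suc (toℕ i) ≟ toℕ j ⌋ ∨ ⌊ suc (toℕ j) ≟ toℕ i ⌋

P : ℕ → Graph
P m = record { V = Fin m ; adj = pathAdj m }

cycleAdj : (n : ℕ) → Fin n → Fin n → Bool
cycleAdj n i j = pathAdj n i j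
  ∨ (⌊ toℕ i ≟ 0 ⌋ ∧ ⌊ toℕ j ≟ n ∸ 1 ⌋)
  ∨ (⌊ toℕ j ≟ 0 ⌋ ∧ ⌊ toℕ i ≟ n ∸ 1 ⌋)

C : ℕ → Graph
C n = record { V = Fin n ; adj = cycleAdj n }

_⋆_ : Graph → Graph → Graph
G ⋆ H = record
  { V   = V G × V H
  ; adj = λ { (x₁ , x₂) (y₁ , y₂) → adj G x₁ y₁ ∨ adj H x₂ y₂ } }

record Automorphism (G : Graph) : Set where
  field
    perm     : V G ↔ V G
    preserve : ∀ x y → adj G (Inverse.to perm x) (Inverse.to perm y) ≡ adj G x y
open Automorphism public

-- An edge labeling with d labels: a label for each edge (given as a function on
-- ordered pairs, required to be symmetric on edges; values on non-edges are irrelevant).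
record EdgeLabeling (G : Graph) (d : ℕ) : Set where
  field
    label : V G → V G → Fin d
    sym   : ∀ x y → adj G x y ≡ true → label x y ≡ label y x
open EdgeLabeling public

Preserves : {G : Graph} {d : ℕ} → Automorphism G → EdgeLabeling G d → Set
Preserves {G} σ ℓ = ∀ x y → adj G x y ≡ true →
  label ℓ (Inverse.to (perm σ) x) (Inverse.to (perm σ) y) ≡ label ℓ x y

Distinguishing : {G : Graph} {d : ℕ} → EdgeLabeling G d → Set
Distinguishing {G} ℓ = ∀ (σ : Automorphism G) → Preserves σ ℓ →
  ∀ x → Inverse.to (perm σ) x ≡ x

HasDistLabeling : Graph → ℕ → Set
HasDistLabeling G d = Σ (EdgeLabeling G d) Distinguishing

DistIndexIs : Graph → ℕ → Set
DistIndexIs G d = HasDistLabeling G d × (∀ d′ → d′ < d → ¬ HasDistLabeling G d′)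

-- A labelling with two labels is distinguishing as soon as the edges labelled 1 form a spanning
-- subgraph T without nontrivial automorphisms: an automorphism preserving the labels maps the edges
-- and the non-edges of T to themselves. For mn ≥ 6 the grid P_m ⋆ P_n contains such a T, a triangle
-- with pendant paths of lengths 1 and mn − 4 passing through every cell, and C_m, C_n contain P_m, P_n.
-- One label never suffices, since reflecting the first factor is a nontrivial automorphism.
-- P₂ ⋆ P₂ is K₄, each of whose 2-labellings is preserved by a transposition or a double transposition.

module Submission where

open import Defs renaming (sym to label-sym)
open import Data.Nat using (ℕ; zero; suc; _+_; _*_; _∸_; _≤_; _<_; z≤n; s≤s; z<s; _≡ᵇ_; _<ᵇ_; _<?_)
open import Data.Nat.Properties
open import Data.Fin using (Fin; toℕ; fromℕ<; combine; remQuot; opposite; zero; suc)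
open import Data.Fin.Properties
  using (toℕ<n; toℕ≤pred[n]; fromℕ<-toℕ; toℕ-fromℕ<; remQuot-combine; combine-remQuot; toℕ-combine;
         opposite-prop; opposite-involutive; all?)
  renaming (_≟_ to _≟ᶠ_)
open import Data.Bool using (Bool; true; false; _∨_; _∧_; T; if_then_else_)
import Data.Bool as Bool
open import Data.Bool.Properties using (∨-comm; ∨-zeroʳ; ∧-comm)
open import Data.Unit using (tt)
open import Data.Empty using (⊥; ⊥-elim)
open import Data.Sum using (_⊎_; inj₁; inj₂)
open import Data.Product using (_×_; _,_; ∃; proj₁; proj₂)
open import Data.Product.Properties using (≡-dec)
open import Data.Product.Function.NonDependent.Propositional using (_×-↔_)
open import Data.List using (List; []; _∷_)
open import Data.List.Relation.Unary.Any using (Any; any?; satisfied)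
open import Function using (_∘_)
open import Function.Bundles using (Inverse; mk↔ₛ′; _⇔_; mk⇔)
open import Function.Construct.Identity using (↔-id)
open import Relation.Binary.Definitions using (DecidableEquality; tri<; tri≈; tri>)
open import Relation.Binary.PropositionalEquality
open import Relation.Nullary using (¬_; Dec; yes; no; ¬?; contradiction)
open import Relation.Nullary.Decidable using (⌊_⌋; does-⇔; dec-true; isYes≗does; map′; from-yes; _×-dec_; _→-dec_)
open import Relation.Unary using (Decidable)

∨≡true⁻ : ∀ x {y} → x ∨ y ≡ true → x ≡ true ⊎ y ≡ true
∨≡true⁻ true  _  = inj₁ refl
∨≡true⁻ false eq = inj₂ eq

∨≡trueˡ : ∀ {x} y → x ≡ true → x ∨ y ≡ true
∨≡trueˡ y refl = refl

∨≡trueʳ : ∀ x {y} → y ≡ true → x ∨ y ≡ true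
∨≡trueʳ x refl = ∨-zeroʳ x

isYes-⇔ : ∀ {A B : Set} → A ⇔ B → (a? : Dec A) (b? : Dec B) → ⌊ a? ⌋ ≡ ⌊ b? ⌋
isYes-⇔ A⇔B a? b? = trans (isYes≗does a?) (trans (does-⇔ A⇔B a? b?) (sym (isYes≗does b?)))

≡ᵇ≡true⇒≡ : ∀ m n → (m ≡ᵇ n) ≡ true → m ≡ n
≡ᵇ≡true⇒≡ m n eq = ≡ᵇ⇒≡ m n (subst T (sym eq) tt)

≡ᵇ-refl : ∀ m → (m ≡ᵇ m) ≡ true
≡ᵇ-refl zero    = refl
≡ᵇ-refl (suc m) = ≡ᵇ-refl m

involutiveAutomorphism : (G : Graph) (π : V G → V G) → (∀ x → π (π x) ≡ x) →
  (∀ x y → adj G (π x) (π y) ≡ adj G x y) → Automorphism G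
involutiveAutomorphism G π π-involutive π-adj =
  record { perm = mk↔ₛ′ π π π-involutive π-involutive ; preserve = π-adj }

⋆-automorphismˡ : (G H : Graph) → Automorphism G → Automorphism (G ⋆ H)
⋆-automorphismˡ G H σ = record
  { perm     = perm σ ×-↔ ↔-id (V H)
  ; preserve = λ (x₁ , x₂) (y₁ , y₂) → cong (_∨ adj H x₂ y₂) (preserve σ x₁ y₁)
  }

¬HasDistLabeling<2 : (G : Graph) (σ : Automorphism G) (x : V G) → Inverse.to (perm σ) x ≢ x →
  ∀ d → d < 2 → ¬ HasDistLabeling G d
¬HasDistLabeling<2 G σ x σx≢x zero _ (ℓ , _) with label ℓ x x
... | ()
¬HasDistLabeling<2 G σ x σx≢x 1    _ (ℓ , ℓ-dist) =
  σx≢x (ℓ-dist σ (λ y z _ → Fin1-unique _ _) x)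
  where
    Fin1-unique : (i j : Fin 1) → i ≡ j
    Fin1-unique zero zero = refl
¬HasDistLabeling<2 G σ x σx≢x (suc (suc _)) (s≤s (s≤s ()))

DistIndexIs2 : (G : Graph) → HasDistLabeling G 2 → (σ : Automorphism G) (x : V G) →
  Inverse.to (perm σ) x ≢ x → DistIndexIs G 2
DistIndexIs2 G dist σ x σx≢x = dist , ¬HasDistLabeling<2 G σ x σx≢x

∸-successor⇔ : ∀ {M a b} → a ≤ M → b ≤ M → (suc (M ∸ a) ≡ M ∸ b) ⇔ (suc b ≡ a)
∸-successor⇔ {M} a≤M b≤M = mk⇔
  (λ eq → sym (∸-cancelˡ-≡ (m≤n⇒m≤1+n a≤M) (s≤s b≤M) (trans (+-∸-assoc 1 a≤M) eq)))
  (λ eq → trans (sym (+-∸-assoc 1 a≤M)) (cong (suc M ∸_) (sym eq)))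

∸≡0⇔ : ∀ {M a} → a ≤ M → (M ∸ a ≡ 0) ⇔ (a ≡ M)
∸≡0⇔ {M} a≤M = mk⇔ (λ eq → ∸-cancelˡ-≡ a≤M ≤-refl (trans eq (sym (n∸n≡0 M))))
                   (λ eq → trans (cong (M ∸_) eq) (n∸n≡0 M))

∸≡id⇔ : ∀ {M a} → a ≤ M → (M ∸ a ≡ M) ⇔ (a ≡ 0)
∸≡id⇔ {M} a≤M = mk⇔ (∸-cancelˡ-≡ a≤M z≤n) (cong (M ∸_))

pathAdj-opposite : ∀ k (i j : Fin k) → pathAdj k (opposite i) (opposite j) ≡ pathAdj k i j
pathAdj-opposite (suc M) i j rewrite opposite-prop i | opposite-prop j =
  trans (cong₂ _∨_ (reflect (toℕ≤pred[n] i) (toℕ≤pred[n] j)) (reflect (toℕ≤pred[n] j) (toℕ≤pred[n] i)))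
        (∨-comm ⌊ suc (toℕ j) ≟ toℕ i ⌋ ⌊ suc (toℕ i) ≟ toℕ j ⌋)
  where
    reflect : ∀ {a b} → a ≤ M → b ≤ M → ⌊ suc (M ∸ a) ≟ M ∸ b ⌋ ≡ ⌊ suc b ≟ a ⌋
    reflect {a} {b} a≤M b≤M = isYes-⇔ (∸-successor⇔ a≤M b≤M) (suc (M ∸ a) ≟ M ∸ b) (suc b ≟ a)

cycleAdj-opposite : ∀ k (i j : Fin k) → cycleAdj k (opposite i) (opposite j) ≡ cycleAdj k i j
cycleAdj-opposite (suc M) i j = cong₂ _∨_ (pathAdj-opposite (suc M) i j)
  (trans (cong₂ _∨_ (cong₂ _∧_ (first i) (last j)) (cong₂ _∧_ (first j) (last i)))
         (trans (cong₂ _∨_ (∧-comm (is M i) (is 0 j)) (∧-comm (is M j) (is 0 i)))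
                (∨-comm (is 0 j ∧ is M i) (is 0 i ∧ is M j))))
  where
    is : ℕ → Fin (suc M) → Bool
    is k x = ⌊ toℕ x ≟ k ⌋
    first : ∀ x → is 0 (opposite x) ≡ is M x
    first x rewrite opposite-prop x =
      isYes-⇔ (∸≡0⇔ (toℕ≤pred[n] x)) (M ∸ toℕ x ≟ 0) (toℕ x ≟ M)
    last : ∀ x → is M (opposite x) ≡ is 0 x
    last x rewrite opposite-prop x =
      isYes-⇔ (∸≡id⇔ (toℕ≤pred[n] x)) (M ∸ toℕ x ≟ M) (toℕ x ≟ 0)

FinGraph : (k : ℕ) → (Fin k → Fin k → Bool) → Graph
FinGraph k R = record { V = Fin k ; adj = R }

reflectionˡ : ∀ {k} (R : Fin k → Fin k → Bool) (H : Graph) →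
  (∀ i j → R (opposite i) (opposite j) ≡ R i j) → Automorphism (FinGraph k R ⋆ H)
reflectionˡ {k} R H R-opposite = ⋆-automorphismˡ (FinGraph k R) H
  (involutiveAutomorphism (FinGraph k R) opposite opposite-involutive R-opposite)

DistIndexIs2-reflectable : ∀ m (R : Fin m → Fin m → Bool) (H : Graph) → 2 ≤ m → V H →
  (∀ i j → R (opposite i) (opposite j) ≡ R i j) →
  HasDistLabeling (FinGraph m R ⋆ H) 2 → DistIndexIs (FinGraph m R ⋆ H) 2
DistIndexIs2-reflectable (suc (suc k)) R H _ y R-opposite dist =
  DistIndexIs2 _ dist (reflectionˡ R H R-opposite) (zero , y) (λ ())
DistIndexIs2-reflectable (suc zero) R H (s≤s ()) _ _ _

-- The rigid graph

rigidArc : ℕ → ℕ → Bool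
rigidArc zero    b = (b ≡ᵇ 2) ∨ (b ≡ᵇ 3)
rigidArc (suc a) b = b ≡ᵇ suc (suc a)

-- On {0, …, N−1}: the triangle 0 2 3, the pendant vertex 1 at 2 and the path 3 — 4 — ⋯ — N−1.
rigidAdj : ℕ → ℕ → Bool
rigidAdj a b = rigidArc a b ∨ rigidArc b a

_~_ : ℕ → ℕ → Set
a ~ b = rigidAdj a b ≡ true

rigidAdj-sym : ∀ a b → rigidAdj a b ≡ rigidAdj b a
rigidAdj-sym a b = ∨-comm (rigidArc a b) (rigidArc b a)

rigidAdj-step : ∀ a → suc a ~ suc (suc a)
rigidAdj-step a rewrite ≡ᵇ-refl a = refl

rigidAdj-stepᵒ : ∀ a → suc (suc a) ~ suc a
rigidAdj-stepᵒ a = trans (rigidAdj-sym (suc (suc a)) (suc a)) (rigidAdj-step a)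

rigidAdj-0⁻ : ∀ b → 0 ~ b → b ≡ 2 ⊎ b ≡ 3
rigidAdj-0⁻ zero ()
rigidAdj-0⁻ (suc b) eq with ∨≡true⁻ (rigidArc 0 (suc b)) eq
... | inj₂ ()
... | inj₁ arc with ∨≡true⁻ (suc b ≡ᵇ 2) arc
...   | inj₁ b≡2 = inj₁ (≡ᵇ≡true⇒≡ _ 2 b≡2)
...   | inj₂ b≡3 = inj₂ (≡ᵇ≡true⇒≡ _ 3 b≡3)

rigidAdj-suc⁻ : ∀ a b → suc a ~ b →
  b ≡ a ⊎ b ≡ suc (suc a) ⊎ (b ≡ 0 × (a ≡ 1 ⊎ a ≡ 2))
rigidAdj-suc⁻ a b eq with ∨≡true⁻ (b ≡ᵇ suc (suc a)) eq
rigidAdj-suc⁻ a b       eq | inj₁ up = inj₂ (inj₁ (≡ᵇ≡true⇒≡ b _ up))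
rigidAdj-suc⁻ a zero    eq | inj₂ down with ∨≡true⁻ (suc a ≡ᵇ 2) down
... | inj₁ a≡1 = inj₂ (inj₂ (refl , inj₁ (suc-injective (≡ᵇ≡true⇒≡ _ 2 a≡1))))
... | inj₂ a≡2 = inj₂ (inj₂ (refl , inj₂ (suc-injective (≡ᵇ≡true⇒≡ _ 3 a≡2))))
rigidAdj-suc⁻ a (suc b) eq | inj₂ down = inj₁ (sym (suc-injective (≡ᵇ≡true⇒≡ (suc a) _ down)))

rigidAdj-1⁻ : ∀ b → 1 ~ b → b ≡ 2
rigidAdj-1⁻ b eq with rigidAdj-suc⁻ 0 b eq
rigidAdj-1⁻ .0 () | inj₁ refl
... | inj₂ (inj₁ b≡2)           = b≡2
... | inj₂ (inj₂ (_ , inj₁ ()))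
... | inj₂ (inj₂ (_ , inj₂ ()))

rigidAdj-path⁻ : ∀ a → 3 ≤ a → ∀ b → suc a ~ b → b ≡ a ⊎ b ≡ suc (suc a)
rigidAdj-path⁻ a 3≤a b eq with rigidAdj-suc⁻ a b eq
... | inj₁ b≡a                     = inj₁ b≡a
... | inj₂ (inj₁ b≡2+a)            = inj₂ b≡2+a
... | inj₂ (inj₂ (_ , inj₁ refl)) = contradiction 3≤a λ { (s≤s ()) }
... | inj₂ (inj₂ (_ , inj₂ refl)) = contradiction 3≤a λ { (s≤s (s≤s ())) }

module RigidAdjAutomorphism (N : ℕ) (6≤N : 6 ≤ N) (f : ℕ → ℕ)
  (f< : ∀ k → k < N → f k < N)
  (f-injective : ∀ a b → a < N → b < N → f a ≡ f b → a ≡ b)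
  (f-surjective : ∀ k → k < N → ∃ λ a → a < N × f a ≡ k)
  (f-adj : ∀ a b → a < N → b < N → rigidAdj (f a) (f b) ≡ rigidAdj a b) where

  private
    small< : ∀ k → T (k <ᵇ 6) → k < N
    small< k k<6 = <-≤-trans (<ᵇ⇒< k 6 k<6) 6≤N

    f-~ : ∀ {a b} → a < N → b < N → a ~ b → f a ~ f b
    f-~ a<N b<N a~b = trans (f-adj _ _ a<N b<N) a~b

    f-≢ : ∀ {a b} → a < N → b < N → a ≢ b → f a ≢ f b
    f-≢ a<N b<N a≢b eq = a≢b (f-injective _ _ a<N b<N eq)

    leaf-image : ∀ a c → a < N → (∀ b → a ~ b → b ≡ c) →
      ∀ {k₁ k₂} → k₁ < N → k₂ < N → f a ~ k₁ → f a ~ k₂ → k₁ ≡ k₂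
    leaf-image a c a<N only-c k₁<N k₂<N fa~k₁ fa~k₂
      with f-surjective _ k₁<N | f-surjective _ k₂<N
    ... | b₁ , b₁<N , refl | b₂ , b₂<N , refl = cong f (trans (pull b₁<N fa~k₁) (sym (pull b₂<N fa~k₂)))
      where
        pull : ∀ {b} → b < N → f a ~ f b → b ≡ c
        pull {b} b<N fa~fb = only-c b (trans (sym (f-adj a b a<N b<N)) fa~fb)

    degree3-image : ∀ {a b₁ b₂ b₃} → a < N → b₁ < N → b₂ < N → b₃ < N →
      b₁ ≢ b₂ → b₁ ≢ b₃ → b₂ ≢ b₃ → a ~ b₁ → a ~ b₂ → a ~ b₃ →
      ∀ u v → ¬ (∀ k → f a ~ k → k ≡ u ⊎ k ≡ v)
    degree3-image {b₁ = b₁} {b₂} {b₃} a<N b₁<N b₂<N b₃<N b₁≢b₂ b₁≢b₃ b₂≢b₃ a~b₁ a~b₂ a~b₃ u v within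
      with within (f b₁) (f-~ a<N b₁<N a~b₁) | within (f b₂) (f-~ a<N b₂<N a~b₂)
         | within (f b₃) (f-~ a<N b₃<N a~b₃)
    ... | inj₁ p | inj₁ q | _      = f-≢ b₁<N b₂<N b₁≢b₂ (trans p (sym q))
    ... | inj₂ p | inj₂ q | _      = f-≢ b₁<N b₂<N b₁≢b₂ (trans p (sym q))
    ... | inj₁ p | inj₂ _ | inj₁ r = f-≢ b₁<N b₃<N b₁≢b₃ (trans p (sym r))
    ... | inj₂ p | inj₁ _ | inj₂ r = f-≢ b₁<N b₃<N b₁≢b₃ (trans p (sym r))
    ... | inj₁ _ | inj₂ q | inj₂ r = f-≢ b₂<N b₃<N b₂≢b₃ (trans q (sym r))
    ... | inj₂ _ | inj₁ q | inj₁ r = f-≢ b₂<N b₃<N b₂≢b₃ (trans q (sym r))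

    at : ∀ {a k b} → f a ≡ k → k ~ b → f a ~ b
    at eq = subst (_~ _) (sym eq)

    from : ∀ {a k b} → f a ≡ k → f a ~ b → k ~ b
    from eq = subst (_~ _) eq

    1-leaf-image : ∀ {k₁ k₂} → k₁ < N → k₂ < N → f 1 ~ k₁ → f 1 ~ k₂ → k₁ ≡ k₂
    1-leaf-image = leaf-image 1 2 (small< 1 tt) rigidAdj-1⁻

    -- 1 and N − 1 are the only leaves
    f1-leaf : f 1 ≡ 1 ⊎ suc (f 1) ≡ N
    f1-leaf with f 1 in eq
    ... | 0 = contradiction (1-leaf-image (small< 2 tt) (small< 3 tt) (at eq refl) (at eq refl)) λ ()
    ... | 1 = inj₁ refl
    ... | 2 = contradiction (1-leaf-image (small< 1 tt) (small< 3 tt) (at eq refl) (at eq refl)) λ ()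
    ... | 3 = contradiction (1-leaf-image (small< 2 tt) (small< 4 tt) (at eq refl) (at eq refl)) λ ()
    ... | suc (suc (suc (suc j))) with 5 + j ≟ N
    ...   | yes 5+j≡N = inj₂ 5+j≡N
    ...   | no  5+j≢N = contradiction
                (1-leaf-image (<-trans (n<1+n _) 4+j<N) (≤∧≢⇒< 4+j<N 5+j≢N)
                  (at eq (rigidAdj-stepᵒ (2 + j))) (at eq (rigidAdj-step (3 + j))))
                (<⇒≢ (<-trans (n<1+n _) (n<1+n _)))
      where
        4+j<N : 4 + j < N
        4+j<N = subst (_< N) eq (f< 1 (small< 1 tt))

    -- N − 2 has degree 2 while 2 has degree 3
    f1≢N-1 : ∀ a → 4 ≤ a → f 1 ≡ suc a → suc (suc a) ≢ N
    f1≢N-1 (suc a) (s≤s 3≤a) f1≡2+a 3+a≡N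
      with rigidAdj-path⁻ (suc a) (m≤n⇒m≤1+n 3≤a) (f 2) (from f1≡2+a (f-~ (small< 1 tt) (small< 2 tt) refl))
    ... | inj₂ f2≡3+a = <-irrefl (trans f2≡3+a 3+a≡N) (f< 2 (small< 2 tt))
    ... | inj₁ f2≡1+a = degree3-image {b₁ = 1} {3} {0} (small< 2 tt) (small< 1 tt) (small< 3 tt) (small< 0 tt)
            (λ ()) (λ ()) (λ ()) refl refl refl a (suc (suc a))
            (λ k f2~k → rigidAdj-path⁻ a 3≤a k (from f2≡1+a f2~k))

    f1 : f 1 ≡ 1
    f1 with f1-leaf
    ... | inj₁ f1≡1 = f1≡1
    ... | inj₂ 1+f1≡N with f 1 in eq
    ...   | zero  = contradiction (subst (6 ≤_) (sym 1+f1≡N) 6≤N) λ { (s≤s ()) }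
    ...   | suc a = ⊥-elim (f1≢N-1 a (≤-pred (≤-pred (subst (6 ≤_) (sym 1+f1≡N) 6≤N))) eq 1+f1≡N)

    f2 : f 2 ≡ 2
    f2 = rigidAdj-1⁻ (f 2) (from f1 (f-~ (small< 1 tt) (small< 2 tt) refl))

    f3 : f 3 ≡ 3
    f3 with rigidAdj-suc⁻ 1 (f 3) (from f2 (f-~ (small< 2 tt) (small< 3 tt) refl))
    ... | inj₁ f3≡1 = contradiction (trans f3≡1 (sym f1)) (f-≢ (small< 3 tt) (small< 1 tt) λ ())
    ... | inj₂ (inj₁ f3≡3) = f3≡3
    ... | inj₂ (inj₂ (f3≡0 , _)) = ⊥-elim
          (degree3-image {b₁ = 2} {4} {0} (small< 3 tt) (small< 2 tt) (small< 4 tt) (small< 0 tt)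
            (λ ()) (λ ()) (λ ()) refl refl refl 2 3 (λ k f3~k → rigidAdj-0⁻ k (from f3≡0 f3~k)))

    f0 : f 0 ≡ 0
    f0 with rigidAdj-suc⁻ 1 (f 0) (from f2 (f-~ (small< 2 tt) (small< 0 tt) refl))
    ... | inj₁ f0≡1 = contradiction (trans f0≡1 (sym f1)) (f-≢ (small< 0 tt) (small< 1 tt) λ ())
    ... | inj₂ (inj₁ f0≡3) = contradiction (trans f0≡3 (sym f3)) (f-≢ (small< 0 tt) (small< 3 tt) λ ())
    ... | inj₂ (inj₂ (f0≡0 , _)) = f0≡0

    -- along the path, each vertex is the only unused neighbour of its predecessor
    f-path : ∀ j → 3 + j < N → f (3 + j) ≡ 3 + j × f (2 + j) ≡ 2 + j
    f-path zero    _     = f3 , f2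
    f-path (suc j) 4+j<N with f-path j (<-trans (n<1+n _) 4+j<N)
    ... | f3+j , f2+j with rigidAdj-suc⁻ (2 + j) (f (4 + j)) (from f3+j (f-~ 3+j<N 4+j<N (rigidAdj-step (2 + j))))
      where
        3+j<N : 3 + j < N
        3+j<N = <-trans (n<1+n _) 4+j<N
    ...   | inj₁ f4+j≡2+j = contradiction (trans f4+j≡2+j (sym f2+j))
                              (f-≢ 4+j<N (<-trans (n<1+n _) (<-trans (n<1+n _) 4+j<N)) (>⇒≢ (<-trans (n<1+n _) (n<1+n _))))
    ...   | inj₂ (inj₁ f4+j≡4+j) = f4+j≡4+j , f3+j
    ...   | inj₂ (inj₂ (f4+j≡0 , _)) = contradiction (trans f4+j≡0 (sym f0)) (f-≢ 4+j<N (small< 0 tt) λ ())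

  fixes : ∀ k → k < N → f k ≡ k
  fixes 0 _ = f0
  fixes 1 _ = f1
  fixes 2 _ = f2
  fixes (suc (suc (suc j))) 3+j<N = proj₁ (f-path j 3+j<N)

-- Labelling the edges of a rigid spanning subgraph

record RigidNumbering (G : Graph) (N : ℕ) : Set where
  field
    index        : V G → ℕ
    vertex       : ℕ → V G
    index<       : ∀ x → index x < N
    vertex-index : ∀ x → vertex (index x) ≡ x
    index-vertex : ∀ k → k < N → index (vertex k) ≡ k
    vertex-adj   : ∀ a b → a < N → b < N → a ~ b → adj G (vertex a) (vertex b) ≡ true

indicator : Bool → Fin 2
indicator b = if b then suc zero else zero

indicator-injective : ∀ {b c} → indicator b ≡ indicator c → b ≡ c
indicator-injective {false} {false} _ = refl
indicator-injective {true}  {true}  _ = refl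

module _ {G : Graph} {N : ℕ} (ν : RigidNumbering G N) where
  open RigidNumbering ν

  private
    index-injective : ∀ x y → index x ≡ index y → x ≡ y
    index-injective x y eq = trans (sym (vertex-index x)) (trans (cong vertex eq) (vertex-index y))

    index-adj : ∀ x y → index x ~ index y → adj G x y ≡ true
    index-adj x y ix~iy = subst₂ (λ u v → adj G u v ≡ true) (vertex-index x) (vertex-index y)
      (vertex-adj (index x) (index y) (index< x) (index< y) ix~iy)

    non-edge : ∀ x y → adj G x y ≡ false → rigidAdj (index x) (index y) ≡ false
    non-edge x y x≁y with rigidAdj (index x) (index y) in ix~iy
    ... | false = refl
    ... | true  with trans (sym x≁y) (index-adj x y ix~iy)
    ...   | ()

  rigidLabeling : EdgeLabeling G 2
  rigidLabeling = record
    { label = λ x y → indicator (rigidAdj (index x) (index y))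
    ; sym   = λ x y _ → cong indicator (rigidAdj-sym (index x) (index y))
    }

  rigidLabeling-preserved⇒rigidAdj-preserved : (σ : Automorphism G) → Preserves σ rigidLabeling →
    let open Inverse (perm σ) in
    ∀ x y → rigidAdj (index (to x)) (index (to y)) ≡ rigidAdj (index x) (index y)
  rigidLabeling-preserved⇒rigidAdj-preserved σ σ-pres x y with adj G x y in x~y
  ... | true  = indicator-injective (σ-pres x y x~y)
  ... | false = trans (non-edge (to x) (to y) (trans (preserve σ x y) x~y)) (sym (non-edge x y x~y))
    where open Inverse (perm σ)

  rigidLabeling-distinguishing : 6 ≤ N → Distinguishing rigidLabeling
  rigidLabeling-distinguishing 6≤N σ σ-pres x = index-injective (to x) x (begin
    index (to x)                   ≡⟨ cong (index ∘ to) (vertex-index x) ⟨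
    index (to (vertex (index x)))  ≡⟨ fixes (index x) (index< x) ⟩
    index x                        ∎)
    where
      open Inverse (perm σ)
      open ≡-Reasoning
      to-injective : ∀ {x y} → to x ≡ to y → x ≡ y
      to-injective {x} {y} eq = trans (sym (strictlyInverseʳ x)) (trans (cong from eq) (strictlyInverseʳ y))
      f : ℕ → ℕ
      f = index ∘ to ∘ vertex
      f-injective : ∀ a b → a < N → b < N → f a ≡ f b → a ≡ b
      f-injective a b a<N b<N fa≡fb = trans (sym (index-vertex a a<N))
        (trans (cong index (to-injective (index-injective _ _ fa≡fb))) (index-vertex b b<N))
      f-surjective : ∀ k → k < N → ∃ λ a → a < N × f a ≡ k
      f-surjective k k<N = index (from (vertex k)) , index< _ ,
        trans (cong (index ∘ to) (vertex-index _)) (trans (cong index (strictlyInverseˡ (vertex k))) (index-vertex k k<N))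
      f-adj : ∀ a b → a < N → b < N → rigidAdj (f a) (f b) ≡ rigidAdj a b
      f-adj a b a<N b<N = trans (rigidLabeling-preserved⇒rigidAdj-preserved σ σ-pres (vertex a) (vertex b))
        (cong₂ rigidAdj (index-vertex a a<N) (index-vertex b b<N))
      open RigidAdjAutomorphism N 6≤N f (λ k _ → index< _) f-injective f-surjective f-adj

-- The rigid graph inside a grid

module Grid (m n : ℕ) (2≤m : 2 ≤ m) (2≤n : 2 ≤ n) where

  private
    0<m : 0 < m
    0<m = <-trans z<s 2≤m
    0<n : 0 < n
    0<n = <-trans z<s 2≤n

  N : ℕ
  N = m * n

  n<N : n < N
  n<N = <-≤-trans (m<m+n n (subst (0 <_) (sym (+-identityʳ n)) 0<n)) (*-monoˡ-≤ n 2≤m)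

  Cell : Set
  Cell = Fin m × Fin n

  Adjacent : Cell → Cell → Set
  Adjacent x y = adj (P m ⋆ P n) x y ≡ true

  Adjacent-sym : ∀ x y → Adjacent x y → Adjacent y x
  Adjacent-sym (a , b) (a′ , b′) = trans (cong₂ _∨_ (pathAdj-sym m a′ a) (pathAdj-sym n b′ b))
    where
      pathAdj-sym : ∀ k (i j : Fin k) → pathAdj k i j ≡ pathAdj k j i
      pathAdj-sym k i j = ∨-comm ⌊ suc (toℕ i) ≟ toℕ j ⌋ ⌊ suc (toℕ j) ≟ toℕ i ⌋

  private
    successor⇒pathAdj : ∀ k {i j : Fin k} → suc (toℕ i) ≡ toℕ j → pathAdj k i j ≡ true
    successor⇒pathAdj k {i} {j} eq = ∨≡trueˡ _ (trans (isYes≗does (suc (toℕ i) ≟ toℕ j)) (dec-true (suc (toℕ i) ≟ toℕ j) eq))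

  rowStep : ∀ a a′ b b′ → suc (toℕ a) ≡ toℕ a′ → Adjacent (a , b) (a′ , b′)
  rowStep a a′ b b′ eq = ∨≡trueˡ _ (successor⇒pathAdj m eq)

  columnStep : ∀ a a′ b b′ → suc (toℕ b) ≡ toℕ b′ → Adjacent (a , b) (a′ , b′)
  columnStep a a′ b b′ eq = ∨≡trueʳ (pathAdj m a a′) (successor⇒pathAdj n eq)

  lex : Cell → ℕ
  lex (a , b) = toℕ (combine a b)

  lex< : ∀ x → lex x < N
  lex< (a , b) = toℕ<n (combine a b)

  unlex : ℕ → Cell
  unlex L with L <? N
  ... | yes L<N = remQuot n (fromℕ< L<N)
  ... | no  _   = fromℕ< 0<m , fromℕ< 0<n

  unlex-lex : ∀ x → unlex (lex x) ≡ x
  unlex-lex (a , b) with lex (a , b) <? N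
  ... | yes L<N = trans (cong (remQuot n) (fromℕ<-toℕ (combine a b) L<N)) (remQuot-combine a b)
  ... | no  L≮N = contradiction (lex< (a , b)) L≮N

  lex-unlex : ∀ L → L < N → lex (unlex L) ≡ L
  lex-unlex L L<N with L <? N
  ... | yes L<N = trans (cong toℕ (combine-remQuot {m} n (fromℕ< L<N))) (toℕ-fromℕ< L<N)
  ... | no  L≮N = contradiction L<N L≮N

  unlex-combine : ∀ a b → unlex (n * toℕ a + toℕ b) ≡ (a , b)
  unlex-combine a b = trans (cong unlex (sym (toℕ-combine a b))) (unlex-lex (a , b))

  unlex-cell : ∀ {i j} (i<m : i < m) (j<n : j < n) → unlex (n * i + j) ≡ (fromℕ< i<m , fromℕ< j<n)
  unlex-cell i<m j<n = subst₂ (λ u v → unlex (n * u + v) ≡ (fromℕ< i<m , fromℕ< j<n))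
    (toℕ-fromℕ< i<m) (toℕ-fromℕ< j<n) (unlex-combine (fromℕ< i<m) (fromℕ< j<n))

  lex-step : ∀ x → suc (lex x) < N → Adjacent x (unlex (suc (lex x)))
  lex-step (a , b) 1+L<N with suc (toℕ b) <? n
  ... | yes 1+b<n = subst (Adjacent (a , b)) (sym next) (columnStep a a b (fromℕ< 1+b<n) (sym (toℕ-fromℕ< 1+b<n)))
    where
      next : unlex (suc (lex (a , b))) ≡ (a , fromℕ< 1+b<n)
      next = begin
        unlex (suc (lex (a , b)))                   ≡⟨ cong (unlex ∘ suc) (toℕ-combine a b) ⟩
        unlex (suc (n * toℕ a + toℕ b))             ≡⟨ cong unlex (+-suc (n * toℕ a) (toℕ b)) ⟨
        unlex (n * toℕ a + suc (toℕ b))             ≡⟨ cong (λ v → unlex (n * toℕ a + v)) (toℕ-fromℕ< 1+b<n) ⟨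
        unlex (n * toℕ a + toℕ (fromℕ< 1+b<n))      ≡⟨ unlex-combine a (fromℕ< 1+b<n) ⟩
        (a , fromℕ< 1+b<n)                          ∎
        where open ≡-Reasoning
  ... | no 1+b≮n = subst (Adjacent (a , b)) (sym (trans (cong unlex next-row) (unlex-cell 1+a<m 0<n)))
                     (rowStep a (fromℕ< 1+a<m) b (fromℕ< 0<n) (sym (toℕ-fromℕ< 1+a<m)))
    where
      open ≡-Reasoning
      next-row : suc (lex (a , b)) ≡ n * suc (toℕ a) + 0
      next-row = begin
        suc (lex (a , b))              ≡⟨ cong suc (toℕ-combine a b) ⟩
        suc (n * toℕ a + toℕ b)        ≡⟨ +-suc (n * toℕ a) (toℕ b) ⟨
        n * toℕ a + suc (toℕ b)        ≡⟨ cong (n * toℕ a +_) (≤-antisym (toℕ<n b) (≮⇒≥ 1+b≮n)) ⟩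
        n * toℕ a + n                  ≡⟨ +-comm (n * toℕ a) n ⟩
        n + n * toℕ a                  ≡⟨ *-suc n (toℕ a) ⟨
        n * suc (toℕ a)                ≡⟨ +-identityʳ _ ⟨
        n * suc (toℕ a) + 0            ∎
      1+a<m : suc (toℕ a) < m
      1+a<m = *-cancelˡ-< n (suc (toℕ a)) m (subst₂ _<_ (trans next-row (+-identityʳ _)) (*-comm m n) 1+L<N)

  unlex-step : ∀ L → suc L < N → Adjacent (unlex L) (unlex (suc L))
  unlex-step L 1+L<N = subst (λ K → Adjacent (unlex L) (unlex (suc K))) L≡ (lex-step (unlex L) (subst (λ K → suc K < N) (sym L≡) 1+L<N))
    where
      L≡ : lex (unlex L) ≡ L
      L≡ = lex-unlex L (<-trans (n<1+n L) 1+L<N)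

  private
    cell₀ : ∀ {j} (j<n : j < n) → unlex j ≡ (fromℕ< 0<m , fromℕ< j<n)
    cell₀ {j} j<n = trans (cong (λ u → unlex (u + j)) (sym (*-zeroʳ n))) (unlex-cell 0<m j<n)

    cell₁ : ∀ {j} (j<n : j < n) → unlex (n + j) ≡ (fromℕ< 2≤m , fromℕ< j<n)
    cell₁ {j} j<n = trans (cong (λ u → unlex (u + j)) (sym (*-identityʳ n))) (unlex-cell 2≤m j<n)

  row₀-row₁ : ∀ {j j′} (j<n : j < n) (j′<n : j′ < n) → Adjacent (unlex j) (unlex (n + j′))
  row₀-row₁ j<n j′<n = subst₂ Adjacent (sym (cell₀ j<n)) (sym (cell₁ j′<n))
    (rowStep (fromℕ< 0<m) (fromℕ< 2≤m) (fromℕ< j<n) (fromℕ< j′<n) (trans (cong suc (toℕ-fromℕ< 0<m)) (sym (toℕ-fromℕ< 2≤m))))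

  row₁-step : Adjacent (unlex (n + 0)) (unlex (n + 1))
  row₁-step = subst₂ Adjacent (sym (cell₁ 0<n)) (sym (cell₁ 2≤n))
    (columnStep (fromℕ< 2≤m) (fromℕ< 2≤m) (fromℕ< 0<n) (fromℕ< 2≤n) (trans (cong suc (toℕ-fromℕ< 0<n)) (sym (toℕ-fromℕ< 2≤n))))

  -- Number the cell (1, 0) by 0, the first row by 1, …, n and the remaining cells lexicographically.
  rotate : ℕ → ℕ
  rotate L with <-cmp L n
  ... | tri< _ _ _ = suc L
  ... | tri≈ _ _ _ = 0
  ... | tri> _ _ _ = L

  unrotate : ℕ → ℕ
  unrotate zero    = n
  unrotate (suc k) with k <? n
  ... | yes _ = k
  ... | no  _ = suc k

  unrotate-suc-< : ∀ {k} → k < n → unrotate (suc k) ≡ k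
  unrotate-suc-< {k} k<n with k <? n
  ... | yes _   = refl
  ... | no  k≮n = contradiction k<n k≮n

  unrotate-suc-≮ : ∀ {k} → ¬ k < n → unrotate (suc k) ≡ suc k
  unrotate-suc-≮ {k} k≮n with k <? n
  ... | yes k<n = contradiction k<n k≮n
  ... | no  _   = refl

  unrotate-rotate : ∀ L → unrotate (rotate L) ≡ L
  unrotate-rotate L with <-cmp L n
  ... | tri< L<n _   _            = unrotate-suc-< L<n
  ... | tri≈ _   L≡n _            = sym L≡n
  ... | tri> _   _   (s≤s {n = k} n≤k) with k <? n
  ...   | yes k<n = contradiction n≤k (<⇒≱ k<n)
  ...   | no  _   = refl

  rotate-unrotate : ∀ k → rotate (unrotate k) ≡ k
  rotate-unrotate zero with <-cmp n n
  ... | tri< n<n _ _ = contradiction n<n (<-irrefl refl)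
  ... | tri≈ _   _ _ = refl
  ... | tri> _ _ n>n = contradiction n>n (<-irrefl refl)
  rotate-unrotate (suc k) with k <? n
  ... | yes k<n with <-cmp k n
  ...   | tri< _ _ _   = refl
  ...   | tri≈ k≮n _ _ = contradiction k<n k≮n
  ...   | tri> k≮n _ _ = contradiction k<n k≮n
  rotate-unrotate (suc k) | no k≮n with <-cmp (suc k) n
  ...   | tri< 1+k<n _ _ = contradiction (<-trans (n<1+n k) 1+k<n) k≮n
  ...   | tri≈ _ 1+k≡n _ = contradiction (subst (k <_) 1+k≡n (n<1+n k)) k≮n
  ...   | tri> _ _ _     = refl

  rotate< : ∀ L → L < N → rotate L < N
  rotate< L L<N with <-cmp L n
  ... | tri< L<n _ _ = ≤-<-trans L<n n<N
  ... | tri≈ _ _ _   = ≤-<-trans z≤n L<N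
  ... | tri> _ _ _   = L<N

  unrotate< : ∀ k → k < N → unrotate k < N
  unrotate< zero    _   = n<N
  unrotate< (suc k) k<N with k <? n
  ... | yes _ = <-trans (n<1+n k) k<N
  ... | no  _ = k<N

  vertex : ℕ → Cell
  vertex = unlex ∘ unrotate

  vertex-path : ∀ k → suc (suc k) < N → Adjacent (vertex (suc k)) (vertex (suc (suc k)))
  vertex-path k 2+k<N with k <? n | suc k <? n
  ... | yes _   | yes _     = unlex-step k (<-trans (n<1+n _) 2+k<N)
  ... | yes k<n | no 1+k≮n  = subst (Adjacent (unlex k) ∘ unlex) n+1≡2+k (row₀-row₁ k<n 2≤n)
    where
      n+1≡2+k : n + 1 ≡ suc (suc k)
      n+1≡2+k = trans (+-comm n 1) (cong suc (≤-antisym (≮⇒≥ 1+k≮n) k<n))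
  ... | no  k≮n | yes 1+k<n = contradiction (<-trans (n<1+n k) 1+k<n) k≮n
  ... | no  _   | no  _     = unlex-step (suc k) 2+k<N

  vertex-0-2 : Adjacent (vertex 0) (vertex 2)
  vertex-0-2 = subst₂ Adjacent (cong unlex (+-identityʳ n)) (cong unlex (sym (unrotate-suc-< 2≤n)))
    (Adjacent-sym (unlex 1) (unlex (n + 0)) (row₀-row₁ 2≤n 0<n))

  vertex-0-3 : Adjacent (vertex 0) (vertex 3)
  vertex-0-3 = by-width (2 <? n)
    where
      by-width : Dec (2 < n) → Adjacent (vertex 0) (vertex 3)
      by-width (yes 2<n) = subst (Adjacent (vertex 0)) (cong unlex (sym (unrotate-suc-< 2<n)))
        (subst (λ L → Adjacent (unlex L) (unlex 2)) (+-identityʳ n) (Adjacent-sym (unlex 2) (unlex (n + 0)) (row₀-row₁ 2<n 0<n)))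
      by-width (no 2≮n) = subst (Adjacent (vertex 0)) (cong unlex (sym (unrotate-suc-≮ 2≮n)))
        (subst₂ (λ L K → Adjacent (unlex L) (unlex K)) (+-identityʳ n) (trans (+-comm n 1) (cong suc n≡2)) row₁-step)
        where
          n≡2 : n ≡ 2
          n≡2 = ≤-antisym (≮⇒≥ 2≮n) 2≤n

  vertex-adj : ∀ a b → a < N → b < N → a ~ b → Adjacent (vertex a) (vertex b)
  vertex-adj zero b _ _ 0~b with rigidAdj-0⁻ b 0~b
  ... | inj₁ refl = vertex-0-2
  ... | inj₂ refl = vertex-0-3
  vertex-adj (suc a) b 1+a<N b<N 1+a~b with rigidAdj-suc⁻ a b 1+a~b
  ... | inj₁ refl                      = backwards a 1+a<N 1+a~b
    where
      backwards : ∀ a → suc a < N → suc a ~ a → Adjacent (vertex (suc a)) (vertex a)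
      backwards (suc k) 2+k<N _ = Adjacent-sym (vertex (suc k)) (vertex (suc (suc k))) (vertex-path k 2+k<N)
  ... | inj₂ (inj₁ refl)               = vertex-path a b<N
  ... | inj₂ (inj₂ (refl , inj₁ refl)) = Adjacent-sym (vertex 0) (vertex 2) vertex-0-2
  ... | inj₂ (inj₂ (refl , inj₂ refl)) = Adjacent-sym (vertex 0) (vertex 3) vertex-0-3

  rigidNumbering : (A : Fin m → Fin m → Bool) (B : Fin n → Fin n → Bool) →
    (∀ i j → pathAdj m i j ≡ true → A i j ≡ true) → (∀ i j → pathAdj n i j ≡ true → B i j ≡ true) →
    RigidNumbering (FinGraph m A ⋆ FinGraph n B) N
  rigidNumbering A B A⊇path B⊇path = record
    { index        = rotate ∘ lex
    ; vertex       = vertex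
    ; index<       = λ x → rotate< (lex x) (lex< x)
    ; vertex-index = λ x → trans (cong unlex (unrotate-rotate (lex x))) (unlex-lex x)
    ; index-vertex = λ k k<N → trans (cong rotate (lex-unlex (unrotate k) (unrotate< k k<N))) (rotate-unrotate k)
    ; vertex-adj   = λ a b a<N b<N a~b → ⋆-mono (vertex a) (vertex b) (vertex-adj a b a<N b<N a~b)
    }
    where
      ⋆-mono : ∀ x y → Adjacent x y → adj (FinGraph m A ⋆ FinGraph n B) x y ≡ true
      ⋆-mono (a , b) (a′ , b′) x~y with ∨≡true⁻ (pathAdj m a a′) x~y
      ... | inj₁ a~a′ = ∨≡trueˡ (B b b′) (A⊇path a a′ a~a′)
      ... | inj₂ b~b′ = ∨≡trueʳ (A a a′) (B⊇path b b′ b~b′)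

gridHasDistLabeling : ∀ m n → 2 ≤ m → 2 ≤ n → 6 ≤ m * n →
  (A : Fin m → Fin m → Bool) (B : Fin n → Fin n → Bool) →
  (∀ i j → pathAdj m i j ≡ true → A i j ≡ true) → (∀ i j → pathAdj n i j ≡ true → B i j ≡ true) →
  HasDistLabeling (FinGraph m A ⋆ FinGraph n B) 2
gridHasDistLabeling m n 2≤m 2≤n 6≤N A B A⊇path B⊇path =
  rigidLabeling ν , rigidLabeling-distinguishing ν 6≤N
  where
    ν = Grid.rigidNumbering m n 2≤m 2≤n A B A⊇path B⊇path

-- K₄ = P₂ ⋆ P₂: its finitely many cases are decided by evaluation.

module K₄ where

  K₄ : Graph
  K₄ = P 2 ⋆ P 2

  Vertex : Set
  Vertex = Fin 2 × Fin 2

  _≟ᵥ_ : DecidableEquality Vertex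
  _≟ᵥ_ = ≡-dec _≟ᶠ_ _≟ᶠ_

  ∀-vertex? : {Q : Vertex → Set} → Decidable Q → Dec (∀ x → Q x)
  ∀-vertex? Q? = map′ (λ h x → h (proj₁ x) (proj₂ x)) (λ h i j → h (i , j)) (all? λ i → all? λ j → Q? (i , j))

  v₀ v₁ v₂ v₃ : Vertex
  v₀ = zero , zero
  v₁ = zero , suc zero
  v₂ = suc zero , zero
  v₃ = suc zero , suc zero

  record EdgeValues (A : Set) : Set where
    constructor values
    field e₀₁ e₀₂ e₀₃ e₁₂ e₁₃ e₂₃ : A

  ∀-edgeValues? : {Q : EdgeValues (Fin 2) → Set} → Decidable Q → Dec (∀ s → Q s)
  ∀-edgeValues? Q? = map′ (λ h (values a b c d e f) → h a b c d e f) (λ h a b c d e f → h (values a b c d e f))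
    (all? λ a → all? λ b → all? λ c → all? λ d → all? λ e → all? λ f → Q? (values a b c d e f))

  tabulate : ∀ {k} → EdgeValues (Fin (suc k)) → Vertex → Vertex → Fin (suc k)
  tabulate (values a b c d e f) x y with x | y
  ... | zero , zero         | zero , suc zero     = a
  ... | zero , zero         | suc zero , zero     = b
  ... | zero , zero         | suc zero , suc zero = c
  ... | zero , suc zero     | suc zero , zero     = d
  ... | zero , suc zero     | suc zero , suc zero = e
  ... | suc zero , zero     | suc zero , suc zero = f
  ... | zero , suc zero     | zero , zero         = a
  ... | suc zero , zero     | zero , zero         = b
  ... | suc zero , suc zero | zero , zero         = c
  ... | suc zero , zero     | zero , suc zero     = d
  ... | suc zero , suc zero | zero , suc zero     = e
  ... | suc zero , suc zero | suc zero , zero     = f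
  ... | _                   | _                   = zero

  restrict : EdgeLabeling K₄ 2 → EdgeValues (Fin 2)
  restrict ℓ = values (label ℓ v₀ v₁) (label ℓ v₀ v₂) (label ℓ v₀ v₃) (label ℓ v₁ v₂) (label ℓ v₁ v₃) (label ℓ v₂ v₃)

  label≡tabulate : ∀ ℓ x y → adj K₄ x y ≡ true → label ℓ x y ≡ tabulate (restrict ℓ) x y
  label≡tabulate ℓ (zero , zero)         (zero , zero)         ()
  label≡tabulate ℓ (zero , zero)         (zero , suc zero)     _ = refl
  label≡tabulate ℓ (zero , zero)         (suc zero , zero)     _ = refl
  label≡tabulate ℓ (zero , zero)         (suc zero , suc zero) _ = refl
  label≡tabulate ℓ (zero , suc zero)     (zero , zero)         e = label-sym ℓ v₁ v₀ e
  label≡tabulate ℓ (zero , suc zero)     (zero , suc zero)     ()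
  label≡tabulate ℓ (zero , suc zero)     (suc zero , zero)     _ = refl
  label≡tabulate ℓ (zero , suc zero)     (suc zero , suc zero) _ = refl
  label≡tabulate ℓ (suc zero , zero)     (zero , zero)         e = label-sym ℓ v₂ v₀ e
  label≡tabulate ℓ (suc zero , zero)     (zero , suc zero)     e = label-sym ℓ v₂ v₁ e
  label≡tabulate ℓ (suc zero , zero)     (suc zero , zero)     ()
  label≡tabulate ℓ (suc zero , zero)     (suc zero , suc zero) _ = refl
  label≡tabulate ℓ (suc zero , suc zero) (zero , zero)         e = label-sym ℓ v₃ v₀ e
  label≡tabulate ℓ (suc zero , suc zero) (zero , suc zero)     e = label-sym ℓ v₃ v₁ e
  label≡tabulate ℓ (suc zero , suc zero) (suc zero , zero)     e = label-sym ℓ v₃ v₂ e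
  label≡tabulate ℓ (suc zero , suc zero) (suc zero , suc zero) ()

  PreservesTable : ∀ {k} → EdgeValues (Fin (suc k)) → (Vertex → Vertex) → Set
  PreservesTable s π = ∀ x y → adj K₄ x y ≡ true → tabulate s (π x) (π y) ≡ tabulate s x y

  preservesTable? : ∀ {k} (s : EdgeValues (Fin (suc k))) → Decidable (PreservesTable s)
  preservesTable? s π = ∀-vertex? λ x → ∀-vertex? λ y →
    (adj K₄ x y Bool.≟ true) →-dec (tabulate s (π x) (π y) ≟ᶠ tabulate s x y)

  swap : Vertex → Vertex → Vertex → Vertex
  swap u v x = if ⌊ x ≟ᵥ u ⌋ then v else if ⌊ x ≟ᵥ v ⌋ then u else x

  involutions : List (Vertex → Vertex)
  involutions = swap v₀ v₁ ∷ swap v₀ v₂ ∷ swap v₀ v₃ ∷ swap v₁ v₂ ∷ swap v₁ v₃ ∷ swap v₂ v₃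
    ∷ swap v₀ v₁ ∘ swap v₂ v₃ ∷ swap v₀ v₂ ∘ swap v₁ v₃ ∷ swap v₀ v₃ ∘ swap v₁ v₂ ∷ []

  Symmetry : EdgeValues (Fin 2) → (Vertex → Vertex) → Set
  Symmetry s π = (∀ x → π (π x) ≡ x) × (∀ x y → adj K₄ (π x) (π y) ≡ adj K₄ x y)
               × PreservesTable s π × ¬ (∀ x → π x ≡ x)

  symmetry? : ∀ s → Decidable (Symmetry s)
  symmetry? s π = ∀-vertex? (λ x → π (π x) ≟ᵥ x)
    ×-dec ∀-vertex? (λ x → ∀-vertex? λ y → adj K₄ (π x) (π y) Bool.≟ adj K₄ x y)
    ×-dec preservesTable? s π
    ×-dec ¬? (∀-vertex? λ x → π x ≟ᵥ x)

  every-table-symmetric : ∀ s → Any (Symmetry s) involutions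
  every-table-symmetric = from-yes (∀-edgeValues? λ s → any? (symmetry? s) involutions)

  ¬HasDistLabeling2 : ¬ HasDistLabeling K₄ 2
  ¬HasDistLabeling2 (ℓ , ℓ-dist) = refute (satisfied (every-table-symmetric (restrict ℓ)))
    where
      refute : ∃ (Symmetry (restrict ℓ)) → ⊥
      refute (π , π-involutive , π-adj , π-pres , π≢id) =
        π≢id (ℓ-dist (involutiveAutomorphism K₄ π π-involutive π-adj) ℓ-pres)
        where
          ℓ-pres : ∀ x y → adj K₄ x y ≡ true → label ℓ (π x) (π y) ≡ label ℓ x y
          ℓ-pres x y x~y = begin
            label ℓ (π x) (π y)               ≡⟨ label≡tabulate ℓ (π x) (π y) (trans (π-adj x y) x~y) ⟩
            tabulate (restrict ℓ) (π x) (π y) ≡⟨ π-pres x y x~y ⟩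
            tabulate (restrict ℓ) x y         ≡⟨ label≡tabulate ℓ x y x~y ⟨
            label ℓ x y                       ∎
            where open ≡-Reasoning

  -- The edges labelled 1 and 2 meet only in v₃, so a preserving automorphism fixes v₃, hence v₁, v₂ and v₀.
  asymmetricValues : EdgeValues (Fin 3)
  asymmetricValues = values zero zero zero zero (suc zero) (suc (suc zero))

  withImages : Vertex → Vertex → Vertex → Vertex → Vertex → Vertex
  withImages a b c d (zero , zero)         = a
  withImages a b c d (zero , suc zero)     = b
  withImages a b c d (suc zero , zero)     = c
  withImages a b c d (suc zero , suc zero) = d

  withImages-images : ∀ (f : Vertex → Vertex) x → withImages (f v₀) (f v₁) (f v₂) (f v₃) x ≡ f x
  withImages-images f (zero , zero)         = refl
  withImages-images f (zero , suc zero)     = refl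
  withImages-images f (suc zero , zero)     = refl
  withImages-images f (suc zero , suc zero) = refl

  asymmetricValues-rigid : ∀ a b c d → PreservesTable asymmetricValues (withImages a b c d) →
    ∀ x → withImages a b c d x ≡ x
  asymmetricValues-rigid = from-yes (∀-vertex? λ a → ∀-vertex? λ b → ∀-vertex? λ c → ∀-vertex? λ d →
    preservesTable? asymmetricValues (withImages a b c d) →-dec ∀-vertex? λ x → withImages a b c d x ≟ᵥ x)

  asymmetricLabeling : EdgeLabeling K₄ 3
  asymmetricLabeling = record
    { label = tabulate asymmetricValues
    ; sym   = λ x y _ → tabulate-sym x y
    }
    where
      tabulate-sym : ∀ x y → tabulate asymmetricValues x y ≡ tabulate asymmetricValues y x
      tabulate-sym = from-yes (∀-vertex? λ x → ∀-vertex? λ y →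
        tabulate asymmetricValues x y ≟ᶠ tabulate asymmetricValues y x)

  asymmetricLabeling-distinguishing : Distinguishing asymmetricLabeling
  asymmetricLabeling-distinguishing σ σ-pres x =
    trans (sym (withImages-images to x)) (asymmetricValues-rigid _ _ _ _ images-pres x)
    where
      open Inverse (perm σ)
      images-pres : PreservesTable asymmetricValues (withImages (to v₀) (to v₁) (to v₂) (to v₃))
      images-pres y z y~z = subst₂ (λ u v → tabulate asymmetricValues u v ≡ tabulate asymmetricValues y z)
        (sym (withImages-images to y)) (sym (withImages-images to z)) (σ-pres y z y~z)

  DistIndexIs3 : DistIndexIs K₄ 3
  DistIndexIs3 = (asymmetricLabeling , asymmetricLabeling-distinguishing) , fewer
    where
      reflection : Automorphism K₄
      reflection = reflectionˡ (pathAdj 2) (P 2) (pathAdj-opposite 2)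
      fewer : ∀ d → d < 3 → ¬ HasDistLabeling K₄ d
      fewer 2 _ = ¬HasDistLabeling2
      fewer 0 _ = ¬HasDistLabeling<2 K₄ reflection v₀ (λ ()) 0 (s≤s z≤n)
      fewer 1 _ = ¬HasDistLabeling<2 K₄ reflection v₀ (λ ()) 1 (s≤s (s≤s z≤n))
      fewer (suc (suc (suc _))) (s≤s (s≤s (s≤s ())))

productDistIndexIs2 : ∀ m n (A : Fin m → Fin m → Bool) (B : Fin n → Fin n → Bool) →
  2 ≤ m → 2 ≤ n → 6 ≤ m * n →
  (∀ i j → pathAdj m i j ≡ true → A i j ≡ true) → (∀ i j → pathAdj n i j ≡ true → B i j ≡ true) →
  (∀ i j → A (opposite i) (opposite j) ≡ A i j) →
  DistIndexIs (FinGraph m A ⋆ FinGraph n B) 2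
productDistIndexIs2 m n A B 2≤m 2≤n 6≤N A⊇path B⊇path A-opposite =
  DistIndexIs2-reflectable m A (FinGraph n B) 2≤m (fromℕ< (<-≤-trans z<s 2≤n)) A-opposite
    (gridHasDistLabeling m n 2≤m 2≤n 6≤N A B A⊇path B⊇path)

6≤*-unless-2×2 : ∀ m n → 2 ≤ m → 2 ≤ n → ¬ (m ≡ 2 × n ≡ 2) → 6 ≤ m * n
6≤*-unless-2×2 m n 2≤m 2≤n not-2×2 with m ≟ 2 | n ≟ 2
... | yes refl | yes n≡2 = contradiction (refl , n≡2) not-2×2
... | yes refl | no  n≢2 = *-mono-≤ (≤-refl {2}) (≤∧≢⇒< 2≤n (n≢2 ∘ sym))
... | no  m≢2  | _       = *-mono-≤ (≤∧≢⇒< 2≤m (m≢2 ∘ sym)) 2≤n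

mainTheorem8 :
      (∀ (m n : ℕ) → 2 ≤ m → 2 ≤ n → ¬ (m ≡ 2 × n ≡ 2) → DistIndexIs (P m ⋆ P n) 2)
    × DistIndexIs (P 2 ⋆ P 2) 3
    × (∀ (m n : ℕ) → 3 ≤ m → 3 ≤ n → DistIndexIs (C m ⋆ C n) 2)
    × (∀ (m n : ℕ) → 2 ≤ m → 3 ≤ n → DistIndexIs (P m ⋆ C n) 2)
mainTheorem8 = paths , K₄.DistIndexIs3 , cycles , pathCycle
  where
    path⊆path : ∀ k (i j : Fin k) → pathAdj k i j ≡ true → pathAdj k i j ≡ true
    path⊆path _ _ _ i~j = i~j
    path⊆cycle : ∀ k (i j : Fin k) → pathAdj k i j ≡ true → cycleAdj k i j ≡ true
    path⊆cycle k i j = ∨≡trueˡ _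

    paths : ∀ m n → 2 ≤ m → 2 ≤ n → ¬ (m ≡ 2 × n ≡ 2) → DistIndexIs (P m ⋆ P n) 2
    paths m n 2≤m 2≤n not-2×2 = productDistIndexIs2 m n (pathAdj m) (pathAdj n) 2≤m 2≤n
      (6≤*-unless-2×2 m n 2≤m 2≤n not-2×2) (path⊆path m) (path⊆path n) (pathAdj-opposite m)

    cycles : ∀ m n → 3 ≤ m → 3 ≤ n → DistIndexIs (C m ⋆ C n) 2
    cycles m n 3≤m 3≤n = productDistIndexIs2 m n (cycleAdj m) (cycleAdj n) (<⇒≤ 3≤m) (<⇒≤ 3≤n)
      (≤-trans (m≤m+n 6 3) (*-mono-≤ 3≤m 3≤n)) (path⊆cycle m) (path⊆cycle n) (cycleAdj-opposite m)

    pathCycle : ∀ m n → 2 ≤ m → 3 ≤ n → DistIndexIs (P m ⋆ C n) 2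
    pathCycle m n 2≤m 3≤n = productDistIndexIs2 m n (pathAdj m) (cycleAdj n) 2≤m (<⇒≤ 3≤n)
      (*-mono-≤ 2≤m 3≤n) (path⊆path m) (path⊆cycle n) (pathAdj-opposite m)
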